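{- Let $T$ be a tree with $t$ leaves, where $T$ is neither $K_1$ nor $K_2$. Then $Z_{(1)}(T) = t$, and the minimum $1$-forcing set of $T$ is exactly the set of leaves of $T$.
   Context: Let $G=(V,E)$ be a finite simple graph. Color-change rule (zero forcing): given a set of colored vertices, a colored vertex with exactly one uncolored neighbor colors ("forces") that neighbor. Leaks: for a set $L\subseteq V$, placing a leak on each $v\in L$ means attaching to $v$ one new pendant vertex (adjacent only to $v$) which is never initially colored; consequently no vertex of $L$ can ever force a vertex of $V$. A set $S\subseteq V$ is an $\ell$-forcing set if for every $L\subseteq V$ with $|L|\le \ell$, starting with exactly the vertices of $S$ colored and repeatedly applying the color-change rule in the graph with leaks on $L$, every vertex of $V$ eventually becomes colored. $Z_{(\ell)}(G)$ is the minimum size of an $\ell$-forcing set. A leaf is a vertex of degree $1$. -}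

module Defs where

open import Data.Nat using (ℕ; zero; suc; _+_; _*_; _∸_; _≤_; _<ᵇ_)
open import Data.Bool using (Bool; true; false; if_then_else_; _∧_)
open import Data.Fin using (Fin; toℕ)
open import Data.Fin.Subset using (Subset; _∈_; _∉_; ∣_∣)
open import Data.List using (List; map)
open import Data.Nat.ListAction using (sum)
open import Data.List using () renaming (allFin to allFinL)
open import Data.Vec using (tabulate)
open import Data.Nat using (_≡ᵇ_)
open import Relation.Binary.PropositionalEquality using (_≡_; _≢_)
open import Data.Product using (_×_; Σ; ∃)
open import Function.Bundles using (_⇔_)

record Graph (n : ℕ) : Set where
  field
    adj   : Fin n → Fin n → Bool
    sym   : ∀ i j → adj i j ≡ adj j i
    irrefl : ∀ i → adj i i ≡ false
open Graph public

Adj : ∀ {n} → Graph n → Fin n → Fin n → Set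
Adj G i j = adj G i j ≡ true

degree : ∀ {n} → Graph n → Fin n → ℕ
degree {n} G v = sum (map (λ w → if adj G v w then 1 else 0) (allFinL n))

numEdges : ∀ {n} → Graph n → ℕ
numEdges {n} G =
  sum (map (λ i → sum (map (λ j → if (toℕ i <ᵇ toℕ j) ∧ adj G i j then 1 else 0)
                            (allFinL n)))
           (allFinL n))

data Reach {n} (G : Graph n) : Fin n → Fin n → Set where
  here : ∀ {u} → Reach G u u
  step : ∀ {u w v} → Adj G u w → Reach G w v → Reach G u v

Connected : ∀ {n} → Graph n → Set
Connected G = ∀ u v → Reach G u v

IsTree : ∀ {n} → Graph n → Set
IsTree {n} G = Connected G × (numEdges G + 1 ≡ n)

leaves : ∀ {n} → Graph n → Subset n
leaves G = tabulate (λ v → degree G v ≡ᵇ 1)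

-- A vertex u ∉ L
-- that is colored forces its neighbour v once all other neighbours of u
-- (in V) are colored; a leaked vertex u ∈ L has an extra never-initially
-- colored pendant neighbour, so it can never force a vertex of V.
data Colored {n} (G : Graph n) (S L : Subset n) : Fin n → Set where
  init  : ∀ {v} → v ∈ S → Colored G S L v
  force : ∀ {u v} → Colored G S L u → u ∉ L → Adj G u v →
          (∀ w → Adj G u w → w ≢ v → Colored G S L w) →
          Colored G S L v

IsLForcing : ∀ {n} → ℕ → Graph n → Subset n → Set
IsLForcing {n} ℓ G S = ∀ (L : Subset n) → ∣ L ∣ ≤ ℓ → ∀ v → Colored G S L v

IsMinLForcing : ∀ {n} → ℕ → Graph n → Subset n → Set
IsMinLForcing ℓ G S = IsLForcing ℓ G S × (∀ S′ → IsLForcing ℓ G S′ → ∣ S ∣ ≤ ∣ S′ ∣)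

ZℓIs : ∀ {n} → ℕ → Graph n → ℕ → Set
ZℓIs ℓ G k = Σ _ (λ S → IsMinLForcing ℓ G S × ∣ S ∣ ≡ k)

-- Every 1-forcing set contains every leaf v: with a leak on the only
-- neighbour of v, nothing can ever force v.  Conversely the leaves of a tree
-- with at least two vertices form a 1-forcing set.  Root the tree at the
-- leaked vertex (anywhere if there is no leak) and give every other vertex a
-- parent one step closer to the root.  These n − 1 parent edges are distinct,
-- and a tree has exactly n − 1 edges, so every edge joins a vertex to its
-- parent.  Hence an inner non-root vertex is forced by any of its children as
-- soon as that child's own children are coloured, and the root is forced by
-- any child at the end; children are never leaked.  Inducting from the
-- deepest vertices upwards colours everything.
module Submission where

open import Defs hiding (sym)
open import Data.Nat using (ℕ; zero; suc; _+_; _∸_; _≤_; _<_; z≤n; s≤s; _<ᵇ_)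
open import Data.Nat.Properties hiding (_≟_)
open import Data.Nat.Induction using (<-wellFounded)
open import Data.Nat.ListAction using () renaming (sum to sumᴸ)
open import Data.Bool using (Bool; true; false; if_then_else_; _∧_; not)
open import Data.Bool.Properties using (T-≡) renaming (_≟_ to _≟𝔹_)
open import Data.Fin using (Fin; zero; suc; toℕ; _≟_)
open import Data.Fin.Properties using (any?; toℕ-injective)
open import Data.Fin.Subset using (Subset; _∈_; _∉_; _⊆_; ∣_∣; ⁅_⁆; ⊥; inside; outside)
open import Data.Fin.Subset.Properties
  using ( _∈?_; nonempty?; Empty-unique; ⊥⊆; ∣⊥∣≡0; x∈⁅x⁆; x∈⁅y⁆⇒x≡y; x∉⁅y⁆⇒x≢y; ∣⁅x⁆∣≡1
        ; ⊆-antisym; drop-∷-⊆; p⊆q⇒∣p∣≤∣q∣)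
open import Data.List using (map; allFin) renaming (tabulate to tabulateᴸ)
open import Data.List.Properties using (map-tabulate)
open import Data.Vec using ([]; _∷_; tabulate; here)
open import Data.Vec.Properties using (lookup∘tabulate; lookup⇒[]=; []=⇒lookup)
open import Data.Product using (_×_; _,_; ∃-syntax; proj₁; proj₂)
open import Data.Sum using (_⊎_; inj₁; inj₂)
open import Data.Empty using (⊥-elim)
open import Function using (id; _∘_)
open import Function.Bundles using (Equivalence; _⇔_; mk⇔)
open import Induction.WellFounded using (module All)
open import Relation.Binary.Definitions using (tri<; tri≈; tri>)
import Relation.Binary.Construct.On as On
open import Relation.Nullary using (¬_; yes; no; does; Dec)
open import Relation.Nullary.Decidable using (_×-dec_; _⊎-dec_; ¬?)
open import Relation.Unary using (Decidable)
open import Relation.Binary.PropositionalEquality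
  using (_≡_; _≢_; refl; sym; trans; cong; cong₂; subst; module ≡-Reasoning)
open import Algebra.Properties.CommutativeMonoid.Sum +-0-commutativeMonoid
  using (sum; sum-cong-≗; ∑-distrib-+; ∑-comm; sum-replicate-zero)

𝟙 : Bool → ℕ
𝟙 b = if b then 1 else 0

<ᵇ-true : ∀ {m n} → m < n → (m <ᵇ n) ≡ true
<ᵇ-true m<n = Equivalence.to T-≡ (<⇒<ᵇ m<n)

<ᵇ-false : ∀ {m n} → n ≤ m → (m <ᵇ n) ≡ false
<ᵇ-false {m} {n} n≤m with m <ᵇ n in m<ᵇn
... | true  = ⊥-elim (≤⇒≯ n≤m (<ᵇ⇒< m n (Equivalence.from T-≡ m<ᵇn)))
... | false = refl

+-mono-≤-≡⇒≡ : ∀ {a b c d} → a ≤ b → c ≤ d → a + c ≡ b + d → a ≡ b × c ≡ d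
+-mono-≤-≡⇒≡ {a} {b} {c} {d} a≤b c≤d a+c≡b+d =
  a≡b , +-cancelˡ-≡ a c d (trans a+c≡b+d (cong (_+ d) (sym a≡b)))
  where
  b+c≤a+c : b + c ≤ a + c
  b+c≤a+c = ≤-trans (+-monoʳ-≤ b c≤d) (≤-reflexive (sym a+c≡b+d))
  a≡b : a ≡ b
  a≡b = ≤-antisym a≤b (+-cancelʳ-≤ c b a b+c≤a+c)

least-witness : ∀ {P : ℕ → Set} → Decidable P → ∀ {m} → P m →
                ∃[ k ] P k × (∀ {j} → j < k → ¬ P j)
least-witness P? {zero}  Pm = zero , Pm , λ ()
least-witness P? {suc m} Pm with P? zero
... | yes P0 = zero , P0 , λ ()
... | no ¬P0 with least-witness (P? ∘ suc) Pm
...   | k , Pk , below-k = suc k , Pk , λ { {zero} _ → ¬P0 ; {suc j} (s≤s j<k) → below-k j<k }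

sumᴸ-tabulate : ∀ {n} (f : Fin n → ℕ) → sumᴸ (tabulateᴸ f) ≡ sum f
sumᴸ-tabulate {zero}  f = refl
sumᴸ-tabulate {suc n} f = cong (f zero +_) (sumᴸ-tabulate (f ∘ suc))

sumᴸ-allFin : ∀ n (f : Fin n → ℕ) → sumᴸ (map f (allFin n)) ≡ sum f
sumᴸ-allFin n f = trans (cong sumᴸ (map-tabulate id f)) (sumᴸ-tabulate f)

∑-mono-≤ : ∀ {n} {f g : Fin n → ℕ} → (∀ i → f i ≤ g i) → sum f ≤ sum g
∑-mono-≤ {zero}  f≤g = z≤n
∑-mono-≤ {suc n} f≤g = +-mono-≤ (f≤g zero) (∑-mono-≤ (f≤g ∘ suc))

f≤∑f : ∀ {n} (f : Fin n → ℕ) i → f i ≤ sum f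
f≤∑f f zero    = m≤m+n _ _
f≤∑f f (suc i) = ≤-trans (f≤∑f (f ∘ suc) i) (m≤n+m _ _)

∑-mono-≤-≡⇒≗ : ∀ {n} {f g : Fin n → ℕ} → (∀ i → f i ≤ g i) → sum f ≡ sum g → ∀ i → f i ≡ g i
∑-mono-≤-≡⇒≗ f≤g ∑f≡∑g zero    = proj₁ (+-mono-≤-≡⇒≡ (f≤g zero) (∑-mono-≤ (f≤g ∘ suc)) ∑f≡∑g)
∑-mono-≤-≡⇒≗ f≤g ∑f≡∑g (suc i) =
  ∑-mono-≤-≡⇒≗ (f≤g ∘ suc) (proj₂ (+-mono-≤-≡⇒≡ (f≤g zero) (∑-mono-≤ (f≤g ∘ suc)) ∑f≡∑g)) i

∑-const-1 : ∀ n → sum {n} (λ _ → 1) ≡ n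
∑-const-1 zero    = refl
∑-const-1 (suc n) = cong suc (∑-const-1 n)

∑-indicator : ∀ {n} (k : Fin n) → sum (λ j → 𝟙 (does (j ≟ k))) ≡ 1
∑-indicator {suc n} zero    = cong suc (sum-replicate-zero n)
∑-indicator {suc n} (suc k) = ∑-indicator k

∑-coindicator : ∀ {n} (k : Fin n) → sum (λ j → 𝟙 (not (does (j ≟ k)))) + 1 ≡ n
∑-coindicator {suc n} zero    = trans (cong (_+ 1) (∑-const-1 n)) (+-comm n 1)
∑-coindicator {suc n} (suc k) = cong suc (∑-coindicator k)

∑∑ : ∀ {n} → (Fin n → Fin n → ℕ) → ℕ
∑∑ h = sum (λ i → sum (h i))

∑∑-symmetrise : ∀ {n} (h : Fin n → Fin n → ℕ) → ∑∑ (λ i j → h i j + h j i) ≡ ∑∑ h + ∑∑ h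
∑∑-symmetrise h = begin
  ∑∑ (λ i j → h i j + h j i)                 ≡⟨ sum-cong-≗ (λ i → ∑-distrib-+ (h i) (λ j → h j i)) ⟩
  sum (λ i → sum (h i) + sum (λ j → h j i))  ≡⟨ ∑-distrib-+ (λ i → sum (h i)) (λ i → sum (λ j → h j i)) ⟩
  ∑∑ h + sum (λ i → sum (λ j → h j i))       ≡⟨ cong (∑∑ h +_) (∑-comm (λ i j → h j i)) ⟩
  ∑∑ h + ∑∑ h                                ∎
  where open ≡-Reasoning

p⊆q∧∣q∣≤∣p∣⇒p≡q : ∀ {n} {p q : Subset n} → p ⊆ q → ∣ q ∣ ≤ ∣ p ∣ → p ≡ q
p⊆q∧∣q∣≤∣p∣⇒p≡q {p = []}          {[]}          _   _  = refl
p⊆q∧∣q∣≤∣p∣⇒p≡q {p = outside ∷ p} {outside ∷ q} p⊆q le =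
  cong (outside ∷_) (p⊆q∧∣q∣≤∣p∣⇒p≡q (drop-∷-⊆ p⊆q) le)
p⊆q∧∣q∣≤∣p∣⇒p≡q {p = outside ∷ p} {inside ∷ q}  p⊆q le =
  ⊥-elim (<-irrefl refl (≤-trans le (p⊆q⇒∣p∣≤∣q∣ (drop-∷-⊆ p⊆q))))
p⊆q∧∣q∣≤∣p∣⇒p≡q {p = inside ∷ p}  {outside ∷ q} p⊆q le with p⊆q here
... | ()
p⊆q∧∣q∣≤∣p∣⇒p≡q {p = inside ∷ p}  {inside ∷ q}  p⊆q (s≤s le) =
  cong (inside ∷_) (p⊆q∧∣q∣≤∣p∣⇒p≡q (drop-∷-⊆ p⊆q) le)

x∈p⇒⁅x⁆⊆p : ∀ {n} {x : Fin n} {p} → x ∈ p → ⁅ x ⁆ ⊆ p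
x∈p⇒⁅x⁆⊆p {x = x} x∈p y∈⁅x⁆ = subst (_∈ _) (sym (x∈⁅y⁆⇒x≡y x y∈⁅x⁆)) x∈p

x∈p∧∣p∣≤1⇒p≡⁅x⁆ : ∀ {n} {x : Fin n} {p} → x ∈ p → ∣ p ∣ ≤ 1 → p ≡ ⁅ x ⁆
x∈p∧∣p∣≤1⇒p≡⁅x⁆ {x = x} x∈p ∣p∣≤1 =
  sym (p⊆q∧∣q∣≤∣p∣⇒p≡q (x∈p⇒⁅x⁆⊆p x∈p) (subst (_ ≤_) (sym (∣⁅x⁆∣≡1 x)) ∣p∣≤1))

∣p∣≤1⇒p⊆⁅x⁆ : ∀ {n} (p : Subset (suc n)) → ∣ p ∣ ≤ 1 → ∃[ x ] p ⊆ ⁅ x ⁆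
∣p∣≤1⇒p⊆⁅x⁆ p ∣p∣≤1 with nonempty? p
... | yes (x , x∈p) = x , subst (_⊆ ⁅ x ⁆) (sym (x∈p∧∣p∣≤1⇒p≡⁅x⁆ x∈p ∣p∣≤1)) id
... | no  p-empty   = zero , subst (_⊆ ⁅ zero ⁆) (sym (Empty-unique p-empty)) ⊥⊆

∣tabulate∣≡∑𝟙 : ∀ {n} (b : Fin n → Bool) → ∣ tabulate b ∣ ≡ sum (𝟙 ∘ b)
∣tabulate∣≡∑𝟙 {zero}  b = refl
∣tabulate∣≡∑𝟙 {suc n} b with b zero
... | true  = cong suc (∣tabulate∣≡∑𝟙 (b ∘ suc))
... | false = ∣tabulate∣≡∑𝟙 (b ∘ suc)

∈-tabulate⁺ : ∀ {n} {b : Fin n → Bool} {i} → b i ≡ true → i ∈ tabulate b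
∈-tabulate⁺ {b = b} {i} bi = lookup⇒[]= i (tabulate b) (trans (lookup∘tabulate b i) bi)

∈-tabulate⁻ : ∀ {n} {b : Fin n → Bool} {i} → i ∈ tabulate b → b i ≡ true
∈-tabulate⁻ {b = b} {i} i∈ = trans (sym (lookup∘tabulate b i)) ([]=⇒lookup i∈)

module _ {n} (G : Graph n) where

  Adj-sym : ∀ {u v} → Adj G u v → Adj G v u
  Adj-sym {u} {v} uv = trans (Graph.sym G v u) uv

  neighbours : Fin n → Subset n
  neighbours v = tabulate (adj G v)

  degree≡∣neighbours∣ : ∀ v → degree G v ≡ ∣ neighbours v ∣
  degree≡∣neighbours∣ v = trans (sumᴸ-allFin n (𝟙 ∘ adj G v)) (sym (∣tabulate∣≡∑𝟙 (adj G v)))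

  ∈-leaves⁻ : ∀ {v} → v ∈ leaves G → ∣ neighbours v ∣ ≡ 1
  ∈-leaves⁻ {v} v∈ =
    trans (sym (degree≡∣neighbours∣ v)) (≡ᵇ⇒≡ _ 1 (Equivalence.from T-≡ (∈-tabulate⁻ v∈)))

  ∈-leaves⁺ : ∀ {v} → ∣ neighbours v ∣ ≡ 1 → v ∈ leaves G
  ∈-leaves⁺ {v} ∣N∣≡1 =
    ∈-tabulate⁺ (Equivalence.to T-≡ (≡⇒≡ᵇ _ 1 (trans (degree≡∣neighbours∣ v) ∣N∣≡1)))

  leaf⇒neighbour : ∀ {v} → v ∈ leaves G → ∃[ u ] Adj G v u
  leaf⇒neighbour {v} v∈ with nonempty? (neighbours v)
  ... | yes (u , u∈N) = u , ∈-tabulate⁻ u∈N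
  ... | no  N-empty   = ⊥-elim (0≢1+n (trans (sym (∣⊥∣≡0 n)) ∣⊥∣≡1))
    where
    ∣⊥∣≡1 : ∣ ⊥ {n = n} ∣ ≡ 1
    ∣⊥∣≡1 = subst (λ p → ∣ p ∣ ≡ 1) (Empty-unique N-empty) (∈-leaves⁻ v∈)

  leaf-neighbour-unique : ∀ {v a b} → v ∈ leaves G → Adj G v a → Adj G v b → b ≡ a
  leaf-neighbour-unique {v} {a} v∈ va vb = x∈⁅y⁆⇒x≡y a (subst (_ ∈_) N≡⁅a⁆ (∈-tabulate⁺ vb))
    where
    N≡⁅a⁆ : neighbours v ≡ ⁅ a ⁆
    N≡⁅a⁆ = x∈p∧∣p∣≤1⇒p≡⁅x⁆ (∈-tabulate⁺ va) (≤-reflexive (∈-leaves⁻ v∈))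

  non-leaf⇒other-neighbour : ∀ {v u} → v ∉ leaves G → Adj G v u → ∃[ c ] Adj G v c × c ≢ u
  non-leaf⇒other-neighbour {v} {u} v∉ vu with any? (λ c → (c ∈? neighbours v) ×-dec ¬? (c ≟ u))
  ... | yes (c , c∈N , c≢u) = c , ∈-tabulate⁻ c∈N , c≢u
  ... | no  ∄c = ⊥-elim (v∉ (∈-leaves⁺ (trans (cong ∣_∣ N≡⁅u⁆) (∣⁅x⁆∣≡1 u))))
    where
    N⊆⁅u⁆ : neighbours v ⊆ ⁅ u ⁆
    N⊆⁅u⁆ {c} c∈N with c ≟ u
    ... | yes refl = x∈⁅x⁆ u
    ... | no  c≢u  = ⊥-elim (∄c (c , c∈N , c≢u))
    N≡⁅u⁆ : neighbours v ≡ ⁅ u ⁆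
    N≡⁅u⁆ = ⊆-antisym N⊆⁅u⁆ (x∈p⇒⁅x⁆⊆p (∈-tabulate⁺ vu))

  ∑∑adj≡2*numEdges : ∑∑ (λ i j → 𝟙 (adj G i j)) ≡ numEdges G + numEdges G
  ∑∑adj≡2*numEdges = begin
    ∑∑ (λ i j → 𝟙 (adj G i j))             ≡⟨ sum-cong-≗ (λ i → sum-cong-≗ (halves i)) ⟨
    ∑∑ (λ i j → ordered i j + ordered j i) ≡⟨ ∑∑-symmetrise ordered ⟩
    ∑∑ ordered + ∑∑ ordered                ≡⟨ cong₂ _+_ numEdges≡∑∑ numEdges≡∑∑ ⟨
    numEdges G + numEdges G                ∎
    where
    open ≡-Reasoning
    ordered : Fin n → Fin n → ℕ
    ordered i j = 𝟙 ((toℕ i <ᵇ toℕ j) ∧ adj G i j)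
    numEdges≡∑∑ : numEdges G ≡ ∑∑ ordered
    numEdges≡∑∑ = trans (sumᴸ-allFin n _) (sum-cong-≗ (λ i → sumᴸ-allFin n (ordered i)))
    halves : ∀ i j → ordered i j + ordered j i ≡ 𝟙 (adj G i j)
    halves i j with <-cmp (toℕ i) (toℕ j)
    ... | tri< i<j _ _ rewrite <ᵇ-true i<j | <ᵇ-false (<⇒≤ i<j) = +-identityʳ _
    ... | tri> _ _ j<i rewrite <ᵇ-false (<⇒≤ j<i) | <ᵇ-true j<i = cong 𝟙 (Graph.sym G j i)
    ... | tri≈ _ i≡j _ with refl ← toℕ-injective i≡j
      rewrite <ᵇ-false (≤-refl {toℕ i}) | Graph.irrefl G i = refl

module _ {n} (G : Graph n) {R : Fin n → Fin n → Set} (R? : ∀ i j → Dec (R i j))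
         (R⇒Adj : ∀ {i j} → R i j → Adj G i j) (R-asym : ∀ {i j} → R i j → ¬ R j i) where

  private
    r : Fin n → Fin n → ℕ
    r i j = 𝟙 (does (R? i j))

    r-pair≤adj : ∀ i j → r i j + r j i ≤ 𝟙 (adj G i j)
    r-pair≤adj i j with R? i j | R? j i
    ... | yes Rij | yes Rji = ⊥-elim (R-asym Rij Rji)
    ... | yes Rij | no  _   rewrite R⇒Adj Rij = ≤-refl
    ... | no  _   | yes Rji rewrite Adj-sym G (R⇒Adj Rji) = ≤-refl
    ... | no  _   | no  _   = z≤n

    r-pair≡adj : ∑∑ r ≡ numEdges G → ∀ i j → r i j + r j i ≡ 𝟙 (adj G i j)
    r-pair≡adj ∑∑r≡m i = ∑-mono-≤-≡⇒≗ (r-pair≤adj i) (row-sums i)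
      where
      open ≡-Reasoning
      row-sums : ∀ i → sum (λ j → r i j + r j i) ≡ sum (λ j → 𝟙 (adj G i j))
      row-sums = ∑-mono-≤-≡⇒≗ (λ i → ∑-mono-≤ (r-pair≤adj i)) (begin
        ∑∑ (λ i j → r i j + r j i) ≡⟨ ∑∑-symmetrise r ⟩
        ∑∑ r + ∑∑ r                ≡⟨ cong₂ _+_ ∑∑r≡m ∑∑r≡m ⟩
        numEdges G + numEdges G    ≡⟨ ∑∑adj≡2*numEdges G ⟨
        ∑∑ (λ i j → 𝟙 (adj G i j)) ∎)

  orientation-covers-edges : ∑∑ (λ i j → 𝟙 (does (R? i j))) ≡ numEdges G →
                             ∀ {a b} → Adj G a b → R a b ⊎ R b a
  orientation-covers-edges ∑∑r≡m {a} {b} ab with R? a b | R? b a | r-pair≡adj ∑∑r≡m a b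
  ... | yes Rab | _       | _      = inj₁ Rab
  ... | no  _   | yes Rba | _      = inj₂ Rba
  ... | no  _   | no  _   | 0≡𝟙adj = ⊥-elim (0≢1+n (trans 0≡𝟙adj (cong 𝟙 ab)))

leaves⊆1-forcing : ∀ {n} (G : Graph n) {S} → IsLForcing 1 G S → leaves G ⊆ S
leaves⊆1-forcing G {S} S-forcing {v} v-leaf with leaf⇒neighbour G v-leaf
... | u , vu = colored⇒∈S (S-forcing ⁅ u ⁆ (≤-reflexive (∣⁅x⁆∣≡1 u)) v)
  where
  colored⇒∈S : Colored G S ⁅ u ⁆ v → v ∈ S
  colored⇒∈S (init v∈S)                  = v∈S
  colored⇒∈S (force {u = w} _ w∉⁅u⁆ wv _) =
    ⊥-elim (x∉⁅y⁆⇒x≢y w∉⁅u⁆ (leaf-neighbour-unique G v-leaf vu (Adj-sym G wv)))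

module Rooted {n} (G : Graph n) (connected : Connected G) (root : Fin n) where

  Within : ℕ → Fin n → Set
  Within zero    v = v ≡ root
  Within (suc k) v = v ≡ root ⊎ ∃[ w ] Adj G v w × Within k w

  within? : ∀ k → Decidable (Within k)
  within? zero    v = v ≟ root
  within? (suc k) v = (v ≟ root) ⊎-dec any? (λ w → (adj G v w ≟𝔹 true) ×-dec within? k w)

  reach⇒within : ∀ {v} → Reach G v root → ∃[ k ] Within k v
  reach⇒within here                = zero , refl
  reach⇒within (step {w = w} vw r) with reach⇒within r
  ... | k , w-within = suc k , inj₂ (w , vw , w-within)

  closest : ∀ v → ∃[ k ] Within k v × (∀ {j} → j < k → ¬ Within j v)
  closest v = least-witness (λ k → within? k v) (proj₂ (reach⇒within (connected v root)))

  depth : Fin n → ℕ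
  depth v = proj₁ (closest v)

  depth-minimal : ∀ {v k} → Within k v → depth v ≤ k
  depth-minimal {v} within-k = ≮⇒≥ (λ k<depth → proj₂ (proj₂ (closest v)) k<depth within-k)

  step-towards-root : ∀ {v} → v ≢ root → ∃[ w ] Adj G v w × depth w < depth v
  step-towards-root {v} v≢root with depth v | proj₁ (proj₂ (closest v))
  ... | zero  | v≡root                   = ⊥-elim (v≢root v≡root)
  ... | suc k | inj₁ v≡root              = ⊥-elim (v≢root v≡root)
  ... | suc k | inj₂ (w , vw , w-within) = w , vw , s≤s (depth-minimal w-within)

  parent : Fin n → Fin n
  parent v with v ≟ root
  ... | yes _      = root
  ... | no  v≢root = proj₁ (step-towards-root v≢root)

  parent-spec : ∀ {c} → c ≢ root → Adj G c (parent c) × depth (parent c) < depth c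
  parent-spec {c} c≢root with c ≟ root
  ... | yes c≡root = ⊥-elim (c≢root c≡root)
  ... | no  c≢root = proj₂ (step-towards-root c≢root)

  _IsChildOf_ : Fin n → Fin n → Set
  c IsChildOf v = c ≢ root × v ≡ parent c

  _isChildOf?_ : ∀ c v → Dec (c IsChildOf v)
  c isChildOf? v = ¬? (c ≟ root) ×-dec (v ≟ parent c)

  child-adj : ∀ {c v} → c IsChildOf v → Adj G c v
  child-adj (c≢root , refl) = proj₁ (parent-spec c≢root)

  child-deeper : ∀ {c v} → c IsChildOf v → depth v < depth c
  child-deeper (c≢root , refl) = proj₂ (parent-spec c≢root)

  child-asym : ∀ {c v} → c IsChildOf v → ¬ v IsChildOf c
  child-asym c⊏v v⊏c = <-asym (child-deeper c⊏v) (child-deeper v⊏c)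

  ∑∑child+1≡n : ∑∑ (λ c v → 𝟙 (does (c isChildOf? v))) + 1 ≡ n
  ∑∑child+1≡n = trans (cong (_+ 1) (sum-cong-≗ row)) (∑-coindicator root)
    where
    row : ∀ c → sum (λ v → 𝟙 (does (c isChildOf? v))) ≡ 𝟙 (not (does (c ≟ root)))
    row c with c ≟ root
    ... | yes _ = sum-replicate-zero n
    ... | no  _ = ∑-indicator {n} _

  module _ (edge-count : numEdges G + 1 ≡ n) where

    ∑∑child≡numEdges : ∑∑ (λ c v → 𝟙 (does (c isChildOf? v))) ≡ numEdges G
    ∑∑child≡numEdges = +-cancelʳ-≡ 1 _ _ (trans ∑∑child+1≡n (sym edge-count))

    neighbour⇒child : ∀ {v w} → Adj G v w → ¬ v IsChildOf w → w IsChildOf v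
    neighbour⇒child vw v⋢w
      with orientation-covers-edges G _isChildOf?_ child-adj child-asym ∑∑child≡numEdges vw
    ... | inj₁ v⊏w = ⊥-elim (v⋢w v⊏w)
    ... | inj₂ w⊏v = w⊏v

    module _ {L : Subset n} (L⊆⁅root⁆ : L ⊆ ⁅ root ⁆) where

      private
        Col : Fin n → Set
        Col = Colored G (leaves G) L

      child-forces-parent : ∀ {c v} → c IsChildOf v → Col c → (∀ {y} → y IsChildOf c → Col y) → Col v
      child-forces-parent {c} c⊏v@(c≢root , refl) c-col children-col =
        force c-col c∉L (child-adj c⊏v) siblings
        where
        c∉L : c ∉ L
        c∉L c∈L = c≢root (x∈⁅y⁆⇒x≡y root (L⊆⁅root⁆ c∈L))
        siblings : ∀ w → Adj G c w → w ≢ parent c → Col w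
        siblings w cw w≢parent = children-col (neighbour⇒child cw (λ c⊏w → w≢parent (proj₂ c⊏w)))

      non-root-colored : ∀ v → v ≢ root → Col v
      non-root-colored = All.wfRec (On.wellFounded height <-wellFounded) _ _ colored-below⇒colored
        where
        -- any upper bound on the depths would do in place of sum depth
        height : Fin n → ℕ
        height v = sum depth ∸ depth v
        deeper⇒lower : ∀ {v y} → depth v < depth y → height y < height v
        deeper⇒lower {y = y} v<y = ∸-monoʳ-< v<y (f≤∑f depth y)
        colored-below⇒colored : ∀ v → (∀ {y} → height y < height v → y ≢ root → Col y) →
                                v ≢ root → Col v
        colored-below⇒colored v IH v≢root with v ∈? leaves G
        ... | yes v-leaf = init v-leaf
        ... | no  v-inner with non-leaf⇒other-neighbour G v-inner (proj₁ (parent-spec v≢root))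
        ...   | c , vc , c≢parent = child-forces-parent c⊏v
                  (IH (deeper⇒lower (child-deeper c⊏v)) (proj₁ c⊏v))
                  (λ y⊏c → IH (deeper⇒lower (<-trans (child-deeper c⊏v) (child-deeper y⊏c))) (proj₁ y⊏c))
          where
          c⊏v : c IsChildOf v
          c⊏v = neighbour⇒child vc (λ v⊏c → c≢parent (proj₂ v⊏c))

      all-colored : ∃[ c ] Adj G root c → ∀ v → Col v
      all-colored (c , root-c) v with v ≟ root
      ... | no  v≢root = non-root-colored v v≢root
      ... | yes refl   =
        child-forces-parent c⊏root (non-root-colored c (proj₁ c⊏root)) (λ y⊏c → non-root-colored _ (proj₁ y⊏c))
        where
        c⊏root : c IsChildOf root
        c⊏root = neighbour⇒child root-c (λ root⊏c → proj₁ root⊏c refl)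

connected⇒neighbour : ∀ {m} (G : Graph (2 + m)) → Connected G → ∀ x → ∃[ c ] Adj G x c
connected⇒neighbour G connected zero with connected zero (suc zero)
... | step {w = c} xc _ = c , xc
connected⇒neighbour G connected (suc x) with connected (suc x) zero
... | step {w = c} xc _ = c , xc

leaves-1-forcing : ∀ {m} (T : Graph (2 + m)) → IsTree T → IsLForcing 1 T (leaves T)
leaves-1-forcing T (connected , edge-count) L ∣L∣≤1 with ∣p∣≤1⇒p⊆⁅x⁆ L ∣L∣≤1
... | root , L⊆⁅root⁆ =
  Rooted.all-colored T connected root edge-count L⊆⁅root⁆ (connected⇒neighbour T connected root)

leaves-minimum-1-forcing : ∀ {m} (T : Graph (2 + m)) → IsTree T → IsMinLForcing 1 T (leaves T)
leaves-minimum-1-forcing T tree =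
  leaves-1-forcing T tree , λ S S-forcing → p⊆q⇒∣p∣≤∣q∣ (leaves⊆1-forcing T S-forcing)

minimum-1-forcing≡leaves : ∀ {n} (G : Graph n) {S} →
                           IsLForcing 1 G (leaves G) → IsMinLForcing 1 G S → S ≡ leaves G
minimum-1-forcing≡leaves G leaves-forcing (S-forcing , S-minimum) =
  sym (p⊆q∧∣q∣≤∣p∣⇒p≡q (leaves⊆1-forcing G S-forcing) (S-minimum (leaves G) leaves-forcing))

proposition11 : ∀ {n} (T : Graph n) → IsTree T → ¬ (n ≡ 1) → ¬ (n ≡ 2) →
                ∀ (t : ℕ) → t ≡ ∣ leaves T ∣ →
                ZℓIs 1 T t × (∀ (S : Subset n) → (IsMinLForcing 1 T S ⇔ S ≡ leaves T))
proposition11 {zero} T (_ , edge-count) _ _ _ _ =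
  ⊥-elim (1+n≢0 (trans (+-comm 1 (numEdges T)) edge-count))
proposition11 {suc zero} _ _ n≢1 _ _ _ = ⊥-elim (n≢1 refl)
proposition11 {suc (suc m)} T tree _ _ t refl =
  (leaves T , leaves-minimum , refl) ,
  λ S → mk⇔ (minimum-1-forcing≡leaves T (proj₁ leaves-minimum)) (λ { refl → leaves-minimum })
  where
  leaves-minimum : IsMinLForcing 1 T (leaves T)
  leaves-minimum = leaves-minimum-1-forcing T tree
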